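{- Let $\nu$ be a strict partition and let $\boxtimes\sqcup T$ be a filling of the shifted diagram of $\nu$ in which $\boxtimes$ occupies the cell $(1,1)$ and $T$ is a shifted Littlewood–Richardson tableau of shape $\nu/(1)$. Then shuffling $\boxtimes$ past $T$ (i.e. moving the empty cell $\boxtimes$ by the shifted jeu de taquin inward slide into $(1,1)$ until it reaches an outer corner) consists of two phases. Phase 1: if the entry $y$ east of $\boxtimes$ is a primed letter, slide $\boxtimes$ past $y$ and then south past the entry below it; repeat until there is no primed entry east of $\boxtimes$, then go to Phase 2. Phase 2: slide $\boxtimes$ horizontally to the end of its row.
   Context: Shifted diagram of $\nu=(\nu_1>\dots>\nu_\ell>0)$: cells $(r,c)$ with $1\le r\le\ell$, $r\le c\le r+\nu_r-1$ (row $r$ from the top). Letters $1'<1<2'<2<\cdots$. A shifted semistandard tableau is weakly increasing along rows and down columns, with no unprimed letter repeated in a column and no primed letter repeated in a row, considered in canonical form (the first entry, in reading order — rows left to right from bottom to top — of each family $\{i',i\}$ unprimed). Jeu de taquin slides and rectification are the shifted ones of Sagan and Worley. $T$ is Littlewood–Richardson if, for every $i$, row $i$ of its rectification consists only of letters $i$. -}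

module Defs where

open import Data.Nat using (ℕ; zero; suc; _+_; _*_; _∸_; _≤_; _<_; _>_; _<ᵇ_; _≡ᵇ_)
open import Data.Bool using (Bool; true; false; if_then_else_; _∧_; _∨_)
open import Data.Maybe using (Maybe; just; nothing)
open import Data.List using (List; []; _∷_; length; upTo; cartesianProduct; concatMap; map; _++_)
open import Data.Nat.ListAction using (sum)
open import Data.Bool.ListAction using (any)
open import Data.List.Relation.Unary.All using (All)
open import Data.List.Relation.Unary.Linked using (Linked)
open import Data.Product using (Σ; ∃; _×_; _,_; proj₁; proj₂)
open import Data.Sum using (_⊎_)
open import Data.Unit using (⊤)
open import Relation.Binary.PropositionalEquality using (_≡_; _≢_)
open import Relation.Nullary using (¬_)

-- Letters 1' < 1 < 2' < 2 < ...   (primed i = i', unprimed i = i)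

data Letter : Set where
  primed   : ℕ → Letter
  unprimed : ℕ → Letter

index : Letter → ℕ
index (primed i)   = i
index (unprimed i) = i

rank : Letter → ℕ
rank (primed i)   = 2 * i
rank (unprimed i) = suc (2 * i)

_<ᴸ_ : Letter → Letter → Set
a <ᴸ b = rank a < rank b

_≤ᴸ_ : Letter → Letter → Set
a ≤ᴸ b = rank a ≤ rank b

IsPrimed : Letter → Set
IsPrimed a = ∃ λ i → a ≡ primed i

IsUnprimed : Letter → Set
IsUnprimed a = ∃ λ i → a ≡ unprimed i

-- Fillings: cell (r , c) (row r from the top, column c; 1-based) ↦ entry
-- (nothing = no entry / empty cell)

Filling : Set
Filling = ℕ → ℕ → Maybe Letter

IsPrimedAt : Filling → ℕ → ℕ → Set
IsPrimedAt T r c = ∃ λ i → T r c ≡ just (primed i)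

StrictPartition : List ℕ → Set
StrictPartition ν = Linked _>_ ν × All (λ x → 0 < x) ν

-- partAt ν r = ν_r (1-based), 0 when r = 0 or r > ℓ(ν)
partAt : List ℕ → ℕ → ℕ
partAt ν        zero          = 0
partAt []       (suc r)       = 0
partAt (x ∷ xs) (suc zero)    = x
partAt (x ∷ xs) (suc (suc r)) = partAt xs (suc r)

InShifted : List ℕ → ℕ → ℕ → Set
InShifted ν r c = (1 ≤ r) × (r ≤ c) × (c < r + partAt ν r)

InSkew : List ℕ → List ℕ → ℕ → ℕ → Set
InSkew ν μ r c = InShifted ν r c × ¬ InShifted μ r c

record IsShiftedSST (ν μ : List ℕ) (T : Filling) : Set where
  field
    support-in  : ∀ r c a → T r c ≡ just a → InSkew ν μ r c
    support-all : ∀ r c → InSkew ν μ r c → ∃ λ a → T r c ≡ just a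
    alphabet    : ∀ r c a → T r c ≡ just a → 1 ≤ index a
    rows : ∀ r c c' a b → c < c' → T r c ≡ just a → T r c' ≡ just b →
           (a ≤ᴸ b) × (a ≡ b → IsUnprimed a)
    cols : ∀ r r' c a b → r < r' → T r c ≡ just a → T r' c ≡ just b →
           (a ≤ᴸ b) × (a ≡ b → IsPrimed a)

-- reading order: rows left to right, from bottom to top.
-- Before r' c' r c : cell (r',c') is read before cell (r,c)
Before : ℕ → ℕ → ℕ → ℕ → Set
Before r' c' r c = (r < r') ⊎ ((r' ≡ r) × (c' < c))

-- canonical form: the first entry (in reading order) of each family is
-- unprimed, i.e. every primed entry i' is preceded by an entry of family i
IsCanonical : Filling → Set
IsCanonical T = ∀ r c i → T r c ≡ just (primed i) →
  Σ ℕ λ r' → Σ ℕ λ c' → Σ Letter λ a →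
    Before r' c' r c × T r' c' ≡ just a × index a ≡ i

-- computable canonicalisation (for fillings supported in the diagram of ν)
boxCells : List ℕ → List (ℕ × ℕ)
boxCells ν = cartesianProduct (upTo B) (upTo B)
  where B = suc (length ν + sum ν)

beforeᵇ : ℕ → ℕ → ℕ → ℕ → Bool
beforeᵇ r' c' r c = (r <ᵇ r') ∨ ((r' ≡ᵇ r) ∧ (c' <ᵇ c))

inFamᵇ : ℕ → Maybe Letter → Bool
inFamᵇ i nothing  = false
inFamᵇ i (just a) = index a ≡ᵇ i

hasEarlier : List ℕ → Filling → ℕ → ℕ → ℕ → Bool
hasEarlier ν T r c i =
  any (λ p → beforeᵇ (proj₁ p) (proj₂ p) r c ∧ inFamᵇ i (T (proj₁ p) (proj₂ p))) (boxCells ν)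

canon : List ℕ → Filling → Filling
canon ν T r c with T r c
... | just (primed i) = if hasEarlier ν T r c i then just (primed i) else just (unprimed i)
... | e = e

-- Slide T r c T' p : the empty cell at (r,c) of T slides until it reaches
-- an outer corner; T' is the result, p the list of cells visited by the
-- empty cell (starting with (r,c), ending with the final cell).
-- Rule: the smaller of the east/south neighbours moves in; on a tie, a
-- primed letter moves west (horizontally), an unprimed one moves north.

update : Filling → ℕ → ℕ → Maybe Letter → Filling
update T r c v r' c' = if (r' ≡ᵇ r) ∧ (c' ≡ᵇ c) then v else T r' c'

move : Filling → ℕ → ℕ → ℕ → ℕ → Filling
move T r c r' c' = update (update T r c (T r' c')) r' c' nothing

EastWins : Letter → Maybe Letter → Set
EastWins x nothing  = ⊤
EastWins x (just y) = (x <ᴸ y) ⊎ ((x ≡ y) × IsPrimed x)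

SouthWins : Letter → Maybe Letter → Set
SouthWins y nothing  = ⊤
SouthWins y (just x) = (y <ᴸ x) ⊎ ((y ≡ x) × IsUnprimed y)

data Slide : Filling → ℕ → ℕ → Filling → List (ℕ × ℕ) → Set where
  stop  : ∀ {T r c} → T r (suc c) ≡ nothing → T (suc r) c ≡ nothing →
          Slide T r c T ((r , c) ∷ [])
  east  : ∀ {T r c x T' p} → T r (suc c) ≡ just x → EastWins x (T (suc r) c) →
          Slide (move T r c r (suc c)) r (suc c) T' p →
          Slide T r c T' ((r , c) ∷ p)
  south : ∀ {T r c y T' p} → T (suc r) c ≡ just y → SouthWins y (T r (suc c)) →
          Slide (move T r c (suc r) c) (suc r) c T' p →
          Slide T r c T' ((r , c) ∷ p)

-- Rectification: repeatedly slide into the inner corner at the end of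
-- the last row of the inner shape μ, putting the result in canonical form
-- after each slide.

lastPart : List ℕ → ℕ
lastPart []           = 0
lastPart (x ∷ [])     = x
lastPart (x ∷ y ∷ ys) = lastPart (y ∷ ys)

shrink : List ℕ → List ℕ
shrink []                    = []
shrink (zero ∷ [])           = []
shrink (suc zero ∷ [])       = []
shrink (suc (suc n) ∷ [])    = suc n ∷ []
shrink (x ∷ y ∷ ys)          = x ∷ shrink (y ∷ ys)

cornerRow : List ℕ → ℕ
cornerRow μ = length μ

cornerCol : List ℕ → ℕ
cornerCol μ = length μ + lastPart μ ∸ 1

data Rect (ν : List ℕ) : List ℕ → Filling → Filling → Set where
  done : ∀ {T} → Rect ν [] T (canon ν T)
  step : ∀ {μ T T' p S} → μ ≢ [] →
         Slide T (cornerRow μ) (cornerCol μ) T' p →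
         Rect ν (shrink μ) (canon ν T') S →
         Rect ν μ T S

IsLR : List ℕ → List ℕ → Filling → Set
IsLR ν μ T = ∀ S → Rect ν μ T S → ∀ r c a → S r c ≡ just a → a ≡ unprimed r

-- The predicted path of the empty cell.
-- Phase 1 (m rounds): (j,j) → (j,j+1) → (j+1,j+1) for j = 1..m.
-- Phase 2 in row k = m+1: (k,k) → (k,k+1) → ... → (k, k + ν_k - 1).

phase1 : ℕ → List (ℕ × ℕ)
phase1 m = concatMap (λ j → (suc j , suc j) ∷ (suc j , suc (suc j)) ∷ []) (upTo m)

phase2 : List ℕ → ℕ → List (ℕ × ℕ)
phase2 ν k = (k , k) ∷ map (λ t → (k , k + suc t)) (upTo (partAt ν k ∸ 1))

module Submission where

-- The slide into (1,1) is the whole rectification of T, so by the Littlewood–Richardson property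
-- every entry it leaves in row r has family r. Follow the empty cell from a diagonal cell (j, j).
-- It cannot go south, so the entry x at (j, j+1) moves west into row j and has family j. If the
-- cell then goes south, the entry y at (j+1, j+1) rises into row j; now x and y are both of
-- family j with x directly above y, so column strictness makes x primed, and the cell is back on
-- the diagonal. Otherwise the cell never leaves row j again and runs to its end. In that row x is
-- unprimed: by canonicity a primed x would need an earlier entry of family j in reading order.

open import Defs
open import Data.Nat using (ℕ; suc; _≤_; _<_)
open import Data.List using (List; []; _∷_; length; _++_)
open import Data.Product using (Σ; _×_)
open import Relation.Nullary using (¬_)

open import Data.Nat using (zero; _+_; _*_; _∸_; _≡ᵇ_; z≤n; s≤s; _≟_)
open import Data.Nat.Properties
open import Data.Bool using (true; false)
open import Data.Maybe using (Maybe; just; nothing)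
open import Data.Maybe.Properties using (just-injective)
open import Data.List using (applyUpTo; concatMap)
open import Data.List.Properties using (map-upTo)
open import Data.Product using (_,_; proj₁; proj₂; ∃; ∃₂)
open import Data.Product.Properties using (≡-dec)
open import Data.Sum using (_⊎_; inj₁; inj₂; [_,_]′)
import Data.Sum as Sum
open import Data.Empty using (⊥; ⊥-elim)
open import Data.Unit using (tt)
open import Function using (_∘_)
open import Relation.Binary using (DecidableEquality; tri<; tri≈; tri>)
open import Relation.Nullary using (yes; no; contradiction)
open import Relation.Binary.PropositionalEquality

private
  variable
    A : Set
    ν μ : List ℕ
    T Tc T' : Filling
    r c r' c' a b j B : ℕ
    x y : Letter
    v : Maybe Letter
    p : List (ℕ × ℕ)

_≟ᶜ_ : DecidableEquality (ℕ × ℕ)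
_≟ᶜ_ = ≡-dec _≟_ _≟_

row-≢ : a ≢ r → (a , b) ≢ (r , c)
row-≢ a≢r = a≢r ∘ cong proj₁

col-≢ : b ≢ c → (a , b) ≢ (r , c)
col-≢ b≢c = b≢c ∘ cong proj₂

update-≡ : ∀ T r c v → update T r c v r c ≡ v
update-≡ T r c v with r ≡ᵇ r | ≡⇒≡ᵇ r r refl | c ≡ᵇ c | ≡⇒≡ᵇ c c refl
... | true  | _  | true  | _  = refl
... | true  | _  | false | ()
... | false | () | _     | _

update-≢ : ∀ T v → (a , b) ≢ (r , c) → update T r c v a b ≡ T a b
update-≢ {a} {b} {r} {c} T v ne with a ≡ᵇ r | ≡ᵇ⇒≡ a r | b ≡ᵇ c | ≡ᵇ⇒≡ b c
... | true  | a≡r | true  | b≡c = contradiction (cong₂ _,_ (a≡r _) (b≡c _)) ne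
... | true  | _   | false | _   = refl
... | false | _   | _     | _   = refl

move-source : ∀ T → (r , c) ≢ (r' , c') → move T r c r' c' r c ≡ T r' c'
move-source {r} {c} {r'} {c'} T ne =
  trans (update-≢ (update T r c (T r' c')) nothing ne) (update-≡ T r c (T r' c'))

move-elsewhere : ∀ T → (a , b) ≢ (r , c) → (a , b) ≢ (r' , c') → move T r c r' c' a b ≡ T a b
move-elsewhere {r = r} {c} {r'} {c'} T ne ne′ =
  trans (update-≢ (update T r c (T r' c')) nothing ne′) (update-≢ T (T r' c') ne)

NorthWest : ℕ → ℕ → ℕ → ℕ → Set
NorthWest r c a b = a < r ⊎ b < c

Ahead : ℕ → ℕ → ℕ → ℕ → Set
Ahead r c a b = r < a ⊎ (a ≡ r × c < b)

northwest-≢ : NorthWest r c a b → (a , b) ≢ (r , c)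
northwest-≢ (inj₁ a<r) = row-≢ (<⇒≢ a<r)
northwest-≢ (inj₂ b<c) = col-≢ (<⇒≢ b<c)

northwest-east : NorthWest r c a b → NorthWest r (suc c) a b
northwest-east = Sum.map₂ m<n⇒m<1+n

northwest-south : NorthWest r c a b → NorthWest (suc r) c a b
northwest-south = Sum.map₁ m<n⇒m<1+n

ahead-≢ : Ahead r c a b → (a , b) ≢ (r , c)
ahead-≢ (inj₁ r<a) = row-≢ (>⇒≢ r<a)
ahead-≢ (inj₂ (_ , c<b)) = col-≢ (>⇒≢ c<b)

ahead-east : Ahead r (suc c) a b → Ahead r c a b
ahead-east (inj₁ r<a) = inj₁ r<a
ahead-east (inj₂ (a≡r , c<b)) = inj₂ (a≡r , <-trans (n<1+n _) c<b)

ahead-south : Ahead (suc r) c a b → Ahead r c a b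
ahead-south (inj₁ r<a) = inj₁ (<-trans (n<1+n _) r<a)
ahead-south (inj₂ (refl , _)) = inj₁ (n<1+n _)

slide-fixes-northwest : Slide Tc r c T' p → NorthWest r c a b → T' a b ≡ Tc a b
slide-fixes-northwest (stop _ _) _ = refl
slide-fixes-northwest {Tc} (east _ _ slide) nw =
  trans (slide-fixes-northwest slide (northwest-east nw))
        (move-elsewhere Tc (northwest-≢ nw) (northwest-≢ (northwest-east nw)))
slide-fixes-northwest {Tc} (south _ _ slide) nw =
  trans (slide-fixes-northwest slide (northwest-south nw))
        (move-elsewhere Tc (northwest-≢ nw) (northwest-≢ (northwest-south nw)))

east-settles : Slide (move Tc r c r (suc c)) r (suc c) T' p → T' r c ≡ Tc r (suc c)
east-settles {Tc} {r} {c} slide =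
  trans (slide-fixes-northwest slide (inj₂ (n<1+n c)))
        (move-source {r = r} {c = c} {r' = r} {c' = suc c} Tc (col-≢ (<⇒≢ (n<1+n c))))

south-settles : Slide (move Tc r c (suc r) c) (suc r) c T' p → T' r c ≡ Tc (suc r) c
south-settles {Tc} {r} {c} slide =
  trans (slide-fixes-northwest slide (inj₁ (n<1+n r)))
        (move-source {r = r} {c = c} {r' = suc r} {c' = c} Tc (row-≢ (<⇒≢ (n<1+n r))))

AgreesAhead : Filling → Filling → ℕ → ℕ → Set
AgreesAhead T Tc r c = ∀ a b → Ahead r c a b → Tc a b ≡ T a b

agreesAhead-east : AgreesAhead T Tc r c → AgreesAhead T (move Tc r c r (suc c)) r (suc c)
agreesAhead-east {Tc = Tc} agree a b ahead =
  trans (move-elsewhere Tc (ahead-≢ (ahead-east ahead)) (ahead-≢ ahead)) (agree a b (ahead-east ahead))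

agreesAhead-south : AgreesAhead T Tc r c → AgreesAhead T (move Tc r c (suc r) c) (suc r) c
agreesAhead-south {Tc = Tc} agree a b ahead =
  trans (move-elsewhere Tc (ahead-≢ (ahead-south ahead)) (ahead-≢ ahead)) (agree a b (ahead-south ahead))

east-unvisited : AgreesAhead T Tc r c → Tc r (suc c) ≡ T r (suc c)
east-unvisited agree = agree _ _ (inj₂ (refl , n<1+n _))

south-unvisited : AgreesAhead T Tc r c → Tc (suc r) c ≡ T (suc r) c
south-unvisited agree = agree _ _ (inj₁ (n<1+n _))

rank≤2*index+1 : ∀ x → rank x ≤ suc (2 * index x)
rank≤2*index+1 (primed i)   = n≤1+n _
rank≤2*index+1 (unprimed i) = ≤-refl

2*index≤rank : ∀ x → 2 * index x ≤ rank x
2*index≤rank (primed i)   = ≤-refl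
2*index≤rank (unprimed i) = n≤1+n _

index-<⇒<ᴸ : index x < index y → x <ᴸ y
index-<⇒<ᴸ {x} {y} lt = begin-strict
  rank x            ≤⟨ rank≤2*index+1 x ⟩
  suc (2 * index x) <⟨ n<1+n _ ⟩
  2 + 2 * index x   ≡⟨ *-suc 2 (index x) ⟨
  2 * suc (index x) ≤⟨ *-monoʳ-≤ 2 lt ⟩
  2 * index y       ≤⟨ 2*index≤rank y ⟩
  rank y            ∎
  where open ≤-Reasoning

≤ᴸ⇒index-≤ : x ≤ᴸ y → index x ≤ index y
≤ᴸ⇒index-≤ {x} {y} x≤y = ≮⇒≥ λ y<x → <⇒≱ (index-<⇒<ᴸ {y} {x} y<x) x≤y

rank-injective : rank x ≡ rank y → x ≡ y
rank-injective {primed i}   {primed j}   e = cong primed (*-cancelˡ-≡ i j 2 e)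
rank-injective {primed i}   {unprimed j} e = contradiction e (even≢odd i j)
rank-injective {unprimed i} {primed j}   e = contradiction (sym e) (even≢odd j i)
rank-injective {unprimed i} {unprimed j} e = cong unprimed (*-cancelˡ-≡ i j 2 (suc-injective e))

east-or-south : ∀ x y → EastWins x (just y) ⊎ SouthWins y (just x)
east-or-south x y with <-cmp (rank x) (rank y)
... | tri< x<y _ _ = inj₁ (inj₁ x<y)
... | tri> _ _ y<x = inj₂ (inj₁ y<x)
... | tri≈ _ e _ with rank-injective {x} {y} e
east-or-south (primed i)   _ | tri≈ _ _ _ | refl = inj₁ (inj₂ (refl , i , refl))
east-or-south (unprimed i) _ | tri≈ _ _ _ | refl = inj₂ (inj₂ (refl , i , refl))

SupportedBelow : ℕ → Filling → Set
SupportedBelow B T = ∀ a b → B ≤ a + b → T a b ≡ nothing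

update-supportedBelow : SupportedBelow B T → (B ≤ r + c → v ≡ nothing) →
                        SupportedBelow B (update T r c v)
update-supportedBelow {T = T} {r} {c} {v} below far a b le with (a , b) ≟ᶜ (r , c)
... | yes refl = trans (update-≡ T a b v) (far le)
... | no ne    = trans (update-≢ T v ne) (below a b le)

move-supportedBelow : SupportedBelow B T → r' + c' ≡ suc (r + c) →
                      SupportedBelow B (move T r c r' c')
move-supportedBelow {r = r} {c = c} below e =
  update-supportedBelow
    (update-supportedBelow {r = r} {c} below
      (λ le → below _ _ (≤-trans le (subst (r + c ≤_) (sym e) (n≤1+n (r + c))))))
    (λ _ → refl)

SlideFrom : Filling → ℕ → ℕ → Set
SlideFrom T r c = ∃₂ λ T' p → Slide T r c T' p

slide-step : SlideFrom (move T r c r (suc c)) r (suc c) → SlideFrom (move T r c (suc r) c) (suc r) c →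
             SlideFrom T r c
slide-step {T} {r} {c} = by-neighbours (T r (suc c)) (T (suc r) c) refl refl
  where
    by-neighbours : ∀ e s → T r (suc c) ≡ e → T (suc r) c ≡ s →
                    SlideFrom (move T r c r (suc c)) r (suc c) →
                    SlideFrom (move T r c (suc r) c) (suc r) c → SlideFrom T r c
    by-neighbours nothing  nothing  eastE southE _ _ = _ , _ , stop eastE southE
    by-neighbours (just x) nothing  eastE southE (_ , _ , rest) _ =
      _ , _ , east eastE (subst (EastWins x) (sym southE) tt) rest
    by-neighbours nothing  (just y) eastE southE _ (_ , _ , rest) =
      _ , _ , south southE (subst (SouthWins y) (sym eastE) tt) rest
    by-neighbours (just x) (just y) eastE southE (_ , _ , east-rest) (_ , _ , south-rest) =
      [ (λ wins → _ , _ , east eastE (subst (EastWins x) (sym southE) wins) east-rest)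
      , (λ wins → _ , _ , south southE (subst (SouthWins y) (sym eastE) wins) south-rest)
      ]′ (east-or-south x y)

-- Each step raises r + c by one, and T vanishes once r + c ≥ B.
slide-exists : ∀ n → SupportedBelow B T → B ≤ n + (r + c) → SlideFrom T r c
slide-exists {r = r} {c} zero below le =
  _ , _ , stop (below _ _ (≤-trans le (+-monoʳ-≤ r (n≤1+n c)))) (below _ _ (≤-trans le (n≤1+n _)))
slide-exists {B} {r = r} {c} (suc n) below le =
  slide-step
    (slide-exists n (move-supportedBelow below (+-suc r c))
       (subst (B ≤_) (sym (trans (cong (n +_) (+-suc r c)) (+-suc n (r + c)))) le))
    (slide-exists n (move-supportedBelow below refl) (subst (B ≤_) (sym (+-suc n (r + c))) le))

diagramBound : List ℕ → ℕ
diagramBound []      = 0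
diagramBound (x ∷ ν) = suc (suc (x + diagramBound ν))

inShifted-< : ∀ ν r c → InShifted ν r c → r + c < diagramBound ν
inShifted-< []      (suc r) c (_ , r≤c , c<r) =
  contradiction (subst (c <_) (+-identityʳ (suc r)) c<r) (≤⇒≯ r≤c)
inShifted-< (x ∷ ν) (suc zero) c (_ , _ , c<1+x) =
  s≤s (s≤s (≤-trans (≤-pred c<1+x) (m≤m+n x _)))
inShifted-< (x ∷ ν) (suc (suc r)) (suc c) (_ , s≤s r≤c , s≤s c<end) =
  s≤s (s≤s (≤-trans (subst (_≤ diagramBound ν) (cong suc (sym (+-suc r c))) rest)
                    (m≤n+m (diagramBound ν) x)))
  where
    rest : suc r + c < diagramBound ν
    rest = inShifted-< ν (suc r) c (s≤s z≤n , r≤c , c<end)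

sst-supportedBelow : IsShiftedSST ν μ T → SupportedBelow (diagramBound ν) T
sst-supportedBelow {ν} {T = T} sst a b le with T a b in e
... | nothing = refl
... | just z  = contradiction (inShifted-< ν a b (proj₁ (IsShiftedSST.support-in sst a b z e))) (≤⇒≯ le)

applyUpTo-cong : ∀ {f g : ℕ → A} → (∀ t → f t ≡ g t) → ∀ n → applyUpTo f n ≡ applyUpTo g n
applyUpTo-cong f≗g zero    = refl
applyUpTo-cong f≗g (suc n) = cong₂ _∷_ (f≗g 0) (applyUpTo-cong (f≗g ∘ suc) n)

rowPath : ℕ → ℕ → ℕ → List (ℕ × ℕ)
rowPath r c zero    = (r , c) ∷ []
rowPath r c (suc n) = (r , c) ∷ rowPath r (suc c) n

rowPath-applyUpTo : ∀ r c n → rowPath r c n ≡ applyUpTo (λ t → (r , c + t)) (suc n)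
rowPath-applyUpTo r c zero    = cong (λ c′ → (r , c′) ∷ []) (sym (+-identityʳ c))
rowPath-applyUpTo r c (suc n) =
  cong₂ _∷_ (cong (r ,_) (sym (+-identityʳ c)))
            (trans (rowPath-applyUpTo r (suc c) n)
                   (applyUpTo-cong (λ t → cong (r ,_) (sym (+-suc c t))) (suc n)))

phase2≡rowPath : ∀ ν k → phase2 ν k ≡ rowPath k k (partAt ν k ∸ 1)
phase2≡rowPath ν k =
  trans (cong₂ _∷_ (cong (k ,_) (sym (+-identityʳ k))) (map-upTo _ (partAt ν k ∸ 1)))
        (sym (rowPath-applyUpTo k k (partAt ν k ∸ 1)))

staircase : ℕ → ℕ → List (ℕ × ℕ)
staircase j zero    = []
staircase j (suc m) = (j , j) ∷ (j , suc j) ∷ staircase (suc j) m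

stairStep : ℕ → List (ℕ × ℕ)
stairStep j = (suc j , suc j) ∷ (suc j , suc (suc j)) ∷ []

staircase-applyUpTo : ∀ k m → concatMap stairStep (applyUpTo (k +_) m) ≡ staircase (suc k) m
staircase-applyUpTo k zero    = refl
staircase-applyUpTo k (suc m) =
  cong₂ (λ i rest → (suc i , suc i) ∷ (suc i , suc (suc i)) ∷ rest) (+-identityʳ k)
        (trans (cong (concatMap stairStep) (applyUpTo-cong (+-suc k) m))
               (staircase-applyUpTo (suc k) m))

phase1≡staircase : ∀ m → phase1 m ≡ staircase 1 m
phase1≡staircase = staircase-applyUpTo 0

RowWalk : List ℕ → ℕ → ℕ → List (ℕ × ℕ) → Set
RowWalk ν r c p = Σ ℕ λ n → p ≡ rowPath r c n × suc (c + n) ≡ r + partAt ν r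

rowWalk-last : suc c ≡ r + partAt ν r → RowWalk ν r c ((r , c) ∷ [])
rowWalk-last {c} end = 0 , refl , trans (cong suc (+-identityʳ c)) end

rowWalk-∷ : RowWalk ν r (suc c) p → RowWalk ν r c ((r , c) ∷ p)
rowWalk-∷ {c = c} (n , refl , end) = suc n , refl , trans (cong suc (+-suc c n)) end

rowWalk-phase2 : RowWalk ν r r p → p ≡ phase2 ν r
rowWalk-phase2 {ν} {r} (n , refl , end) =
  sym (trans (phase2≡rowPath ν r) (cong (rowPath r r) length-1))
  where
    length-1 : partAt ν r ∸ 1 ≡ n
    length-1 = cong (_∸ 1) (sym (+-cancelˡ-≡ r (suc n) _ (trans (+-suc r n) end)))

primedAt : T r c ≡ just x → IsPrimed x → IsPrimedAt T r c
primedAt e (i , refl) = i , e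

column-repeat-primed : IsShiftedSST ν μ T → T r c ≡ just x → T (suc r) c ≡ just y →
                       index x ≡ index y → IsPrimed x
column-repeat-primed {x = primed i} _ _ _ _ = i , refl
column-repeat-primed {x = unprimed i} {y = primed .i} sst above below refl =
  contradiction (proj₁ (IsShiftedSST.cols sst _ _ _ _ _ (n<1+n _) above below)) (<-irrefl refl)
column-repeat-primed {x = unprimed i} {y = unprimed .i} sst above below refl
  with proj₂ (IsShiftedSST.cols sst _ _ _ _ _ (n<1+n _) above below) refl
... | _ , ()

inShifted-[1] : ∀ r c → InShifted (1 ∷ []) r c → (r , c) ≡ (1 , 1)
inShifted-[1] (suc zero)    c (_ , 1≤c , c<2) = cong (1 ,_) (≤-antisym (≤-pred c<2) 1≤c)
inShifted-[1] (suc (suc r)) c (_ , r≤c , c<r) =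
  contradiction (subst (c <_) (+-identityʳ _) c<r) (≤⇒≯ r≤c)

canon-index : ∀ ν T r c → T r c ≡ just x → ∃ λ x′ → canon ν T r c ≡ just x′ × index x′ ≡ index x
canon-index ν T r c e with T r c
canon-index ν T r c refl | just (primed i) with hasEarlier ν T r c i
... | true  = _ , refl , refl
... | false = _ , refl , refl
canon-index ν T r c refl | just (unprimed i) = _ , refl , refl

RowIndexed : Filling → Set
RowIndexed S = ∀ r c x → S r c ≡ just x → index x ≡ r

-- Rectifying a tableau of shape ν/(1) is a single slide into (1,1) followed by canonicalisation,
-- which does not change families.
lr-slide-rowIndexed : IsLR ν (1 ∷ []) T → Slide T 1 1 T' p → RowIndexed T'
lr-slide-rowIndexed {ν} {T' = T'} lr slide r c x e =
  let (x₁ , e₁ , i₁) = canon-index ν T' r c e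
      (x₂ , e₂ , i₂) = canon-index ν (canon ν T') r c e₁
  in trans (sym (trans i₂ i₁)) (cong index (lr _ (step (λ ()) slide done) r c x₂ e₂))

module Shuffle {ν : List ℕ} {T T' : Filling}
                (sst : IsShiftedSST ν (1 ∷ []) T) (canonical : IsCanonical T)
                (rowIndexed : RowIndexed T') where

  open IsShiftedSST sst

  occupied-inside : T r c ≡ just x → InShifted ν r c
  occupied-inside {r} {c} {x} e = proj₁ (support-in r c x e)

  vacant-beyond : 1 ≤ r → r ≤ c → (r , c) ≢ (1 , 1) → T r c ≡ nothing → r + partAt ν r ≤ c
  vacant-beyond {r} {c} 1≤r r≤c not-corner vacant = ≮⇒≥ λ c<end →
    let (_ , occupied) = support-all r c ((1≤r , r≤c , c<end) , not-corner ∘ inShifted-[1] r c)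
    in contradiction (trans (sym vacant) occupied) λ ()

  row-ends-after : T r c ≡ just x → T r (suc c) ≡ nothing → suc c ≡ r + partAt ν r
  row-ends-after occupied vacant =
    let (1≤r , r≤c , c<end) = occupied-inside occupied
    in ≤-antisym c<end
         (vacant-beyond 1≤r (m≤n⇒m≤1+n r≤c) (col-≢ (>⇒≢ (s≤s (≤-trans 1≤r r≤c)))) vacant)

  PrimedBesideDiagonal : ℕ → Set
  PrimedBesideDiagonal j = IsPrimedAt T j (suc j)

  ForeignDiagonal : ℕ → Set
  ForeignDiagonal j = ∀ x → T j j ≡ just x → index x ≢ j

  UnchangedBelow : ℕ → Set
  UnchangedBelow j = ∀ a b → j < a → T' a b ≡ T a b

  -- By canonicity a primed j' at (j, j+1) needs an earlier entry of family j in reading order;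
  -- the rows below hold larger families and (j, j) holds none.
  beside-diagonal-unprimed : ForeignDiagonal j → UnchangedBelow j →
                             T j (suc j) ≡ just x → index x ≡ j → ¬ PrimedBesideDiagonal j
  beside-diagonal-unprimed {j} foreign below occupied x∈j (i , primed-i)
    with canonical j (suc j) i primed-i
  ... | r′ , c′ , a , earlier , occupied′ , a∈i = earlier-absurd earlier
    where
      i≡j : i ≡ j
      i≡j = trans (cong index (just-injective (trans (sym primed-i) occupied))) x∈j
      earlier-absurd : Before r′ c′ j (suc j) → ⊥
      earlier-absurd (inj₁ j<r′) =
        <⇒≢ j<r′ (trans (sym (trans a∈i i≡j)) (rowIndexed r′ c′ a (trans (below r′ c′ j<r′) occupied′)))
      earlier-absurd (inj₂ (refl , c′≤j)) with m≤n⇒m<n∨m≡n (≤-pred c′≤j)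
      ... | inj₁ c′<j = <⇒≱ c′<j (proj₁ (proj₂ (occupied-inside occupied′)))
      ... | inj₂ refl = foreign a occupied′ (trans a∈i i≡j)

  row-walk : ∀ {Tc p} j c → suc j < c → T j c ≡ just x → AgreesAhead T Tc j c →
             Slide Tc j c T' p → UnchangedBelow j × RowWalk ν j c p
  row-walk j c _ occupied agree (stop vacant _) =
    (λ a b j<a → agree a b (inj₁ j<a)) ,
    rowWalk-last (row-ends-after occupied (trans (sym (east-unvisited agree)) vacant))
  row-walk j c j+1<c _ agree (east next _ slide) =
    let (below , walk) = row-walk j (suc c) (<-trans j+1<c (n<1+n c))
                           (trans (sym (east-unvisited agree)) next) (agreesAhead-east agree) slide
    in below , rowWalk-∷ walk
  -- An entry rising from (j+1, c) would settle in row j, hence have family j, yet lie east of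
  -- the entry at (j+1, j+1), which keeps its family j + 1.
  row-walk {Tc = Tc} j c j+1<c occupied agree (south {y = y} next _ slide) =
    ⊥-elim (<⇒≱ (n<1+n j) (subst (_≤ j) diagonal∈j+1 (subst (index z ≤_) y∈j z≤y)))
    where
      rising : T (suc j) c ≡ just y
      rising = trans (sym (south-unvisited agree)) next
      y∈j : index y ≡ j
      y∈j = rowIndexed j c y (trans (south-settles slide) next)
      1≤j : 1 ≤ j
      1≤j = proj₁ (occupied-inside occupied)
      c<end : c < suc j + partAt ν (suc j)
      c<end = proj₂ (proj₂ (occupied-inside rising))
      diagonal-occupied : ∃ λ z → T (suc j) (suc j) ≡ just z
      diagonal-occupied =
        support-all _ _ ((s≤s z≤n , ≤-refl , <-trans j+1<c c<end) ,
                         row-≢ (>⇒≢ (s≤s 1≤j)) ∘ inShifted-[1] (suc j) (suc j))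
      z : Letter
      z = proj₁ diagonal-occupied
      z≤y : index z ≤ index y
      z≤y = ≤ᴸ⇒index-≤ {z} {y} (proj₁ (rows _ _ _ _ _ j+1<c (proj₂ diagonal-occupied) rising))
      diagonal∈j+1 : index z ≡ suc j
      diagonal∈j+1 = rowIndexed _ _ z
        (trans (slide-fixes-northwest slide (inj₂ j+1<c))
          (trans (move-elsewhere {r = j} {c} {suc j} {c} Tc (row-≢ (>⇒≢ (n<1+n j))) (col-≢ (<⇒≢ j+1<c)))
            (trans (agree _ _ (inj₁ (n<1+n j))) (proj₂ diagonal-occupied))))

  ShuffleFrom : ℕ → List (ℕ × ℕ) → Set
  ShuffleFrom j p =
    Σ ℕ λ m → (∀ i → i < m → PrimedBesideDiagonal (j + i)) ×
              ¬ PrimedBesideDiagonal (j + m) ×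
              p ≡ staircase j m ++ phase2 ν (j + m)

  shuffle-stop : ¬ PrimedBesideDiagonal j → p ≡ phase2 ν j → ShuffleFrom j p
  shuffle-stop {j} unprimed-beside refl =
    0 , (λ _ ()) ,
    subst (¬_ ∘ PrimedBesideDiagonal) (sym (+-identityʳ j)) unprimed-beside ,
    cong (phase2 ν) (sym (+-identityʳ j))

  shuffle-descend : PrimedBesideDiagonal j → ShuffleFrom (suc j) p →
                    ShuffleFrom j ((j , j) ∷ (j , suc j) ∷ p)
  shuffle-descend {j} primed-beside (m , primed-steps , unprimed-beside , refl) =
    suc m , steps ,
    subst (¬_ ∘ PrimedBesideDiagonal) (sym (+-suc j m)) unprimed-beside ,
    cong (λ k → staircase j (suc m) ++ phase2 ν k) (sym (+-suc j m))
    where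
      steps : ∀ i → i < suc m → PrimedBesideDiagonal (j + i)
      steps zero    _         = subst PrimedBesideDiagonal (sym (+-identityʳ j)) primed-beside
      steps (suc i) (s≤s i<m) = subst PrimedBesideDiagonal (sym (+-suc j i)) (primed-steps i i<m)

  mutual
    from-diagonal : ∀ {Tc p} j → 1 ≤ j → ForeignDiagonal j → AgreesAhead T Tc j j →
                    Slide Tc j j T' p → ShuffleFrom j p
    from-diagonal j 1≤j _ agree (stop vacant′ _) =
      shuffle-stop {j} (λ (_ , e) → contradiction (trans (sym vacant) e) λ ())
                   (sym (trans (phase2≡rowPath ν j) (cong (rowPath j j) (m≤n⇒m∸n≡0 short))))
      where
        vacant : T j (suc j) ≡ nothing
        vacant = trans (sym (east-unvisited agree)) vacant′
        short : partAt ν j ≤ 1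
        short = +-cancelˡ-≤ j _ 1 (subst (j + partAt ν j ≤_) (+-comm 1 j)
                  (vacant-beyond 1≤j (n≤1+n j) (col-≢ (>⇒≢ (s≤s 1≤j))) vacant))
    from-diagonal j _ _ agree (south next _ _) =
      ⊥-elim (1+n≰n (proj₁ (proj₂ (occupied-inside (trans (sym (south-unvisited agree)) next)))))
    from-diagonal j _ foreign agree (east {x = x} next _ slide) =
      beside-diagonal j foreign (trans (sym (east-unvisited agree)) next)
        (rowIndexed j j x (trans (east-settles slide) next)) (agreesAhead-east agree) slide

    beside-diagonal : ∀ {Tc p} j → ForeignDiagonal j → T j (suc j) ≡ just x → index x ≡ j →
                      AgreesAhead T Tc j (suc j) → Slide Tc j (suc j) T' p →
                      ShuffleFrom j ((j , j) ∷ p)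
    beside-diagonal j foreign occupied x∈j agree (stop vacant _) =
      shuffle-stop (beside-diagonal-unprimed foreign (λ a b j<a → agree a b (inj₁ j<a)) occupied x∈j)
        (rowWalk-phase2 (rowWalk-∷ (rowWalk-last
          (row-ends-after occupied (trans (sym (east-unvisited agree)) vacant)))))
    beside-diagonal j foreign occupied x∈j agree (east next _ slide) =
      let (below , walk) = row-walk j (suc (suc j)) (n<1+n (suc j))
                             (trans (sym (east-unvisited agree)) next) (agreesAhead-east agree) slide
      in shuffle-stop (beside-diagonal-unprimed foreign below occupied x∈j)
                      (rowWalk-phase2 (rowWalk-∷ (rowWalk-∷ walk)))
    beside-diagonal j foreign occupied x∈j agree (south {y = y} next _ slide) =
      shuffle-descend
        (primedAt {T = T} occupied (column-repeat-primed sst occupied rising (trans x∈j (sym y∈j))))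
        (from-diagonal (suc j) (s≤s z≤n) foreign′ (agreesAhead-south agree) slide)
      where
        rising : T (suc j) (suc j) ≡ just y
        rising = trans (sym (south-unvisited agree)) next
        y∈j : index y ≡ j
        y∈j = rowIndexed j (suc j) y (trans (south-settles slide) next)
        foreign′ : ForeignDiagonal (suc j)
        foreign′ z occupied′ z∈j+1 =
          1+n≰n (≤-reflexive (trans (sym z∈j+1) (trans (cong index z≡y) y∈j)))
          where
            z≡y : z ≡ y
            z≡y = just-injective (trans (sym occupied′) rising)

lemma4p1 : (ν : List ℕ) (T : Filling) →
    StrictPartition ν → 1 ≤ length ν →
    IsShiftedSST ν (1 ∷ []) T → IsCanonical T → IsLR ν (1 ∷ []) T →
    Σ ℕ λ m →
      (∀ j → j < m → IsPrimedAt T (suc j) (suc (suc j))) ×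
      ¬ IsPrimedAt T (suc m) (suc (suc m)) ×
      Σ Filling λ T' → Slide T 1 1 T' (phase1 m ++ phase2 ν (suc m))
lemma4p1 ν T _ _ sst canonical lr =
  let (T' , p , slide) = slide-exists (diagramBound ν) (sst-supportedBelow sst) (m≤m+n _ 2)
      (m , primed-steps , unprimed-beside , path) =
        Shuffle.from-diagonal sst canonical (lr-slide-rowIndexed lr slide)
          1 ≤-refl corner-empty (λ _ _ _ → refl) slide
  in m , primed-steps , unprimed-beside , T' ,
     subst (Slide T 1 1 T') (trans path (cong (_++ phase2 ν (suc m)) (sym (phase1≡staircase m)))) slide
  where
    corner-empty : ∀ x → T 1 1 ≡ just x → index x ≢ 1
    corner-empty x e _ = proj₂ (IsShiftedSST.support-in sst 1 1 x e) (s≤s z≤n , s≤s z≤n , s≤s (s≤s z≤n))
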